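{- Let $G$ be a graph and $I$ a critical independent set of $G$. Then: (i) $N(I)\cap D(G)=\emptyset$; (ii) $I\cap A(G)=\emptyset$; (iii) there exists a critical independent set $J$ of $G$ with $J\subseteq D(G)\cap I$.
   Context: All graphs are finite and simple. For $S\subseteq V(G)$, $N(S)$ is the set of vertices adjacent to some vertex of $S$. Let $d(G)=\max\{|S|-|N(S)|: S\subseteq V(G)\}$. A critical independent set is an independent set $S$ with $|S|-|N(S)|=d(G)$. Gallai–Edmonds sets: $D(G)$ is the set of vertices $v$ such that some maximum matching of $G$ does not cover $v$; $A(G)$ is the set of vertices not in $D(G)$ adjacent to some vertex of $D(G)$. -}

module Defs where

open import Data.Nat using (ℕ)
open import Data.Bool using (Bool; true; false; _∧_)
open import Data.Fin using (Fin)
open import Data.Fin.Subset using (Subset; _∈_; ∣_∣)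
open import Data.Vec using (tabulate; lookup)
open import Data.List using (allFin)
open import Data.Bool.ListAction using (any)
open import Data.Maybe using (Maybe; just; nothing; is-just)
open import Data.Integer using (ℤ; +_; _-_; _≤_)
open import Data.Product using (Σ; _×_)
open import Relation.Binary.PropositionalEquality using (_≡_)
open import Relation.Nullary using (¬_)

record Graph : Set where
  field
    n      : ℕ
    adj    : Fin n → Fin n → Bool
    sym    : ∀ u v → adj u v ≡ adj v u
    irrefl : ∀ v → adj v v ≡ false
open Graph public

module _ (G : Graph) where

  N : Subset (n G) → Subset (n G)
  N S = tabulate λ v → any (λ u → lookup S u ∧ adj G u v) (allFin (n G))

  Independent : Subset (n G) → Set
  Independent S = ∀ u v → u ∈ S → v ∈ S → adj G u v ≡ false

  surplus : Subset (n G) → ℤ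
  surplus S = + ∣ S ∣ - + ∣ N S ∣

  -- d(G) = max over S of surplus S; attained by S, i.e. surplus S = d(G)
  IsMaxSurplus : Subset (n G) → Set
  IsMaxSurplus S = ∀ T → surplus T ≤ surplus S

  CriticalIndependent : Subset (n G) → Set
  CriticalIndependent S = Independent S × IsMaxSurplus S

  -- A matching, represented as a partial involution m along edges:
  -- m u = just v  means the edge uv is in the matching.
  record Matching : Set where
    field
      mate     : Fin (n G) → Maybe (Fin (n G))
      mate-adj : ∀ u v → mate u ≡ just v → adj G u v ≡ true
      mate-sym : ∀ u v → mate u ≡ just v → mate v ≡ just u
  open Matching public

  -- number of covered vertices (= 2 * number of edges)
  covered : Matching → ℕ
  covered M = ∣ tabulate (λ v → is-just (mate M v)) ∣

  IsMaximumMatching : Matching → Set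
  IsMaximumMatching M = ∀ M' → covered M' Data.Nat.≤ covered M

  InD : Fin (n G) → Set
  InD v = Σ Matching λ M → IsMaximumMatching M × mate M v ≡ nothing

  InA : Fin (n G) → Set
  InA v = ¬ InD v × Σ (Fin (n G)) λ u → InD u × adj G u v ≡ true

-- Critical sets satisfy Hall's condition: if I is critical and S ⊆ N(I) then
-- ∣S∣ ≤ ∣I ∩ N(S)∣, because I ∖ N(S) has no neighbour in S, so removing I ∩ N(S)
-- from I costs at least ∣S∣ neighbours. Hence N(I) can be matched into I. Given any
-- maximum matching M, use this matching on I ∪ N(I) and keep the edges of M that avoid
-- I ∪ N(I): as I is independent, the result is at least as large as M, and strictly
-- larger if M misses a vertex of N(I). This is (i), and (ii) follows since a vertex of
-- I ∩ A(G) has a neighbour in N(I) ∩ D(G). For (iii) take J ⊆ I critical and minimal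
-- under inclusion: then for every x ∈ J even J ∖ {x} satisfies Hall's condition for
-- N(J), and the same exchange turns a maximum matching into one that misses x.

module Submission where

open import Defs
open import Data.Fin using (Fin)
open import Data.Fin.Subset using (Subset; _∈_)
open import Data.Product using (Σ; _×_)
open import Relation.Nullary using (¬_)

open import Data.Bool using (Bool; true; _∧_; if_then_else_)
open import Data.Bool.ListAction using (any)
open import Data.Bool.Properties using (T-≡; T-∧)
open import Data.Fin using (zero; suc)
open import Data.Fin.Properties using (0≢1+n; suc-injective; any?) renaming (_≟_ to _≟ᶠ_)
open import Data.Fin.Subset
  using (∁; ⁅_⁆; _∉_; _⊆_; _⊂_; _∩_; _∪_; _─_; _-_; ∣_∣; Nonempty; Empty; inside; outside)
open import Data.Fin.Subset.Induction using (⊂-wellFounded)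
open import Data.Fin.Subset.Properties
import Data.Integer as ℤ
import Data.Integer.Properties as ℤ
import Data.Integer.Tactic.RingSolver as ℤ-Solver
open import Data.List using (List; []; _∷_; [_]; map; allFin; cartesianProductWith)
open import Data.List.Extrema.Nat using (argmax; f[xs]≤f[argmax])
open import Data.List.Membership.Propositional using (lose) renaming (_∈_ to _∈ˡ_)
open import Data.List.Membership.Propositional.Properties
  using (∈-allFin; ∈-map⁺; ∈-cartesianProductWith⁺)
import Data.List.Relation.Unary.All as All
open import Data.List.Relation.Unary.Any as Any using (satisfied)
open import Data.List.Relation.Unary.Any.Properties using (any⁺; any⁻)
open import Data.Maybe using (Maybe; just; nothing; is-just; _>>=_; _<∣>_; fromMaybe)
open import Data.Maybe.Properties using (just-injective) renaming (≡-dec to ≡-decᵐ)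
open import Data.Nat using (ℕ; zero; suc; _+_; _≤_; _<_; _≤?_; z≤n; s≤s; s≤s⁻¹)
open import Data.Nat.Properties
  using ( ≤-refl; ≤-reflexive; ≤-trans; ≤-<-trans; <⇒≱; ≰⇒>; n≤1+n; +-suc
        ; +-mono-≤; +-monoˡ-≤; +-monoʳ-≤; +-monoˡ-<; +-monoʳ-<
        ; +-cancelˡ-≤; +-cancelʳ-≤; +-cancelˡ-<; +-cancelʳ-<; module ≤-Reasoning )
open import Data.Nat.Tactic.RingSolver using (solve-∀)
open import Data.Product using (∃-syntax; _,_; proj₁; proj₂)
open import Data.Sum using (inj₁; inj₂)
open import Data.Vec using (Vec; []; _∷_; here; there; lookup; tabulate; replicate)
open import Data.Vec.Properties using (lookup∘tabulate; lookup⇒[]=; []=⇒lookup; tabulate-cong)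
open import Function using (_∘_; case_of_; _⇔_; mk⇔; Equivalence)
open import Induction.WellFounded using (Acc; acc)
open import Relation.Binary.PropositionalEquality as ≡
  using (_≡_; _≢_; refl; trans; cong; cong₂)
open import Relation.Nullary using (Dec; yes; no; does; contradiction)
open import Relation.Nullary.Decidable using (_×-dec_; dec-true; dec-false)
open import Relation.Unary using (Decidable)

private
  variable
    k : ℕ
    x y z : Fin k
    p q r S T X Y : Subset k

∣p∣≡∣p∩q∣+∣p─q∣ : ∀ (p q : Subset k) → ∣ p ∣ ≡ ∣ p ∩ q ∣ + ∣ p ─ q ∣
∣p∣≡∣p∩q∣+∣p─q∣ []            []            = refl
∣p∣≡∣p∩q∣+∣p─q∣ (outside ∷ p) (inside  ∷ q) = ∣p∣≡∣p∩q∣+∣p─q∣ p q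
∣p∣≡∣p∩q∣+∣p─q∣ (outside ∷ p) (outside ∷ q) = ∣p∣≡∣p∩q∣+∣p─q∣ p q
∣p∣≡∣p∩q∣+∣p─q∣ (inside  ∷ p) (inside  ∷ q) = cong suc (∣p∣≡∣p∩q∣+∣p─q∣ p q)
∣p∣≡∣p∩q∣+∣p─q∣ (inside  ∷ p) (outside ∷ q) =
  trans (cong suc (∣p∣≡∣p∩q∣+∣p─q∣ p q)) (≡.sym (+-suc _ _))

∣p∪q∣≤∣p∣+∣q∣ : ∀ (p q : Subset k) → ∣ p ∪ q ∣ ≤ ∣ p ∣ + ∣ q ∣
∣p∪q∣≤∣p∣+∣q∣ []            []            = z≤n
∣p∪q∣≤∣p∣+∣q∣ (outside ∷ p) (outside ∷ q) = ∣p∪q∣≤∣p∣+∣q∣ p q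
∣p∪q∣≤∣p∣+∣q∣ (outside ∷ p) (inside  ∷ q) =
  ≤-trans (s≤s (∣p∪q∣≤∣p∣+∣q∣ p q)) (≤-reflexive (≡.sym (+-suc _ _)))
∣p∪q∣≤∣p∣+∣q∣ (inside  ∷ p) (outside ∷ q) = s≤s (∣p∪q∣≤∣p∣+∣q∣ p q)
∣p∪q∣≤∣p∣+∣q∣ (inside  ∷ p) (inside  ∷ q) =
  s≤s (≤-trans (∣p∪q∣≤∣p∣+∣q∣ p q) (+-monoʳ-≤ ∣ p ∣ (n≤1+n _)))

p⊆q∪r⇒∣p∣≤∣q∣+∣r∣ : p ⊆ q ∪ r → ∣ p ∣ ≤ ∣ q ∣ + ∣ r ∣
p⊆q∪r⇒∣p∣≤∣q∣+∣r∣ {q = q} {r = r} p⊆q∪r = ≤-trans (p⊆q⇒∣p∣≤∣q∣ p⊆q∪r) (∣p∪q∣≤∣p∣+∣q∣ q r)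

x∈p─q⇒x∉q : ∀ (p q : Subset k) → x ∈ p ─ q → x ∉ q
x∈p─q⇒x∉q (inside  ∷ p) (outside ∷ q) here         ()
x∈p─q⇒x∉q (_       ∷ p) (_       ∷ q) (there x∈p─q) (there x∈q) = x∈p─q⇒x∉q p q x∈p─q x∈q

x∉p-x : x ∉ p - x
x∉p-x {x = x} {p = p} x∈p-x = x∈p─q⇒x∉q p ⁅ x ⁆ x∈p-x (x∈⁅x⁆ x)

p⊆r∧q⊆r⇒p∪q⊆r : p ⊆ r → q ⊆ r → p ∪ q ⊆ r
p⊆r∧q⊆r⇒p∪q⊆r {p = p} {q = q} p⊆r q⊆r x∈p∪q with x∈p∪q⁻ p q x∈p∪q
... | inj₁ x∈p = p⊆r x∈p
... | inj₂ x∈q = q⊆r x∈q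

x∈p⇒⁅x⁆⊆p : x ∈ p → ⁅ x ⁆ ⊆ p
x∈p⇒⁅x⁆⊆p {x = x} {p = p} x∈p y∈⁅x⁆ = ≡.subst (_∈ p) (≡.sym (x∈⁅y⁆⇒x≡y x y∈⁅x⁆)) x∈p

x∉p⇒p⊆p-x : x ∉ p → p ⊆ p - x
x∉p⇒p⊆p-x x∉p y∈p = x∈p∧x≢y⇒x∈p-y y∈p (λ y≡x → x∉p (≡.subst (_∈ _) y≡x y∈p))

p∩q-x⊆[p-x]∩q : ∀ (p q : Subset k) x → p ∩ q - x ⊆ (p - x) ∩ q
p∩q-x⊆[p-x]∩q p q x y∈ with x∈p∩q⁻ p q (p─q⊆p _ _ y∈)
... | y∈p , y∈q = x∈p∩q⁺ (x∈p∧x∉q⇒x∈p─q y∈p (x∈p─q⇒x∉q (p ∩ q) ⁅ x ⁆ y∈) , y∈q)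

p⊆q∪p─q : ∀ (p q : Subset k) → p ⊆ q ∪ (p ─ q)
p⊆q∪p─q p q {x} x∈p with x ∈? q
... | yes x∈q = x∈p∪q⁺ (inj₁ x∈q)
... | no x∉q  = x∈p∪q⁺ (inj₂ (x∈p∧x∉q⇒x∈p─q x∈p x∉q))

disjoint⇒∣p∣+∣q∣≤∣r∣ : p ⊆ r → q ⊆ r → (∀ {x} → x ∈ p → x ∉ q) → ∣ p ∣ + ∣ q ∣ ≤ ∣ r ∣
disjoint⇒∣p∣+∣q∣≤∣r∣ {p = p} {r = r} {q = q} p⊆r q⊆r disjoint = begin
  ∣ p ∣ + ∣ q ∣          ≤⟨ +-mono-≤ (p⊆q⇒∣p∣≤∣q∣ p⊆r∩p) (p⊆q⇒∣p∣≤∣q∣ q⊆r─p) ⟩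
  ∣ r ∩ p ∣ + ∣ r ─ p ∣  ≡⟨ ≡.sym (∣p∣≡∣p∩q∣+∣p─q∣ r p) ⟩
  ∣ r ∣                  ∎
  where
  open ≤-Reasoning
  p⊆r∩p : p ⊆ r ∩ p
  p⊆r∩p x∈p = x∈p∩q⁺ (p⊆r x∈p , x∈p)
  q⊆r─p : q ⊆ r ─ p
  q⊆r─p x∈q = x∈p∧x∉q⇒x∈p─q (q⊆r x∈q) (λ x∈p → disjoint x∈p x∈q)

∣p∣≤1+∣p-x∣ : ∀ (p : Subset k) x → ∣ p ∣ ≤ suc ∣ p - x ∣
∣p∣≤1+∣p-x∣ p x = begin
  ∣ p ∣                      ≡⟨ ∣p∣≡∣p∩q∣+∣p─q∣ p ⁅ x ⁆ ⟩
  ∣ p ∩ ⁅ x ⁆ ∣ + ∣ p - x ∣  ≤⟨ +-mono-≤ (∣p∩q∣≤∣q∣ p ⁅ x ⁆) ≤-refl ⟩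
  ∣ ⁅ x ⁆ ∣ + ∣ p - x ∣      ≡⟨ cong (_+ ∣ p - x ∣) (∣⁅x⁆∣≡1 x) ⟩
  suc ∣ p - x ∣              ∎
  where open ≤-Reasoning

∣p∣>0⇒Nonempty : ∀ (p : Subset k) → 0 < ∣ p ∣ → Nonempty p
∣p∣>0⇒Nonempty (inside  ∷ p) _ = zero , here
∣p∣>0⇒Nonempty (outside ∷ p) ∣p∣>0 with ∣p∣>0⇒Nonempty p ∣p∣>0
... | x , x∈p = suc x , there x∈p

Empty⇒∣p∣≡0 : ∀ (p : Subset k) → Empty p → ∣ p ∣ ≡ 0
Empty⇒∣p∣≡0 {k} p empty = trans (cong ∣_∣ (Empty-unique empty)) (∣⊥∣≡0 k)

private
  injective-on-tail : ∀ {m} {s} {p : Subset m} {f : Fin (suc m) → Fin k} →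
                      (∀ {x y} → x ∈ s ∷ p → y ∈ s ∷ p → f x ≡ f y → x ≡ y) →
                      (∀ {x y} → x ∈ p → y ∈ p → f (suc x) ≡ f (suc y) → x ≡ y)
  injective-on-tail injective x∈p y∈p eq = suc-injective (injective (there x∈p) (there y∈p) eq)

injectiveOn⇒∣p∣≤∣q∣ : ∀ {m} {p : Subset m} {q : Subset k} (f : Fin m → Fin k) →
                      (∀ {x} → x ∈ p → f x ∈ q) →
                      (∀ {x y} → x ∈ p → y ∈ p → f x ≡ f y → x ≡ y) →
                      ∣ p ∣ ≤ ∣ q ∣
injectiveOn⇒∣p∣≤∣q∣ {p = []}          f _    _         = z≤n
injectiveOn⇒∣p∣≤∣q∣ {p = outside ∷ p} f into injective =
  injectiveOn⇒∣p∣≤∣q∣ (f ∘ suc) (into ∘ there) (injective-on-tail injective)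
injectiveOn⇒∣p∣≤∣q∣ {p = inside  ∷ p} {q = q} f into injective = begin-strict
  ∣ p ∣           ≤⟨ injectiveOn⇒∣p∣≤∣q∣ (f ∘ suc) into-q-f₀ (injective-on-tail injective) ⟩
  ∣ q - f zero ∣  <⟨ x∈p⇒∣p-x∣<∣p∣ (into here) ⟩
  ∣ q ∣           ∎
  where
  open ≤-Reasoning
  into-q-f₀ : x ∈ p → f (suc x) ∈ q - f zero
  into-q-f₀ x∈p = x∈p∧x≢y⇒x∈p-y (into (there x∈p))
    (λ f[1+x]≡f₀ → 0≢1+n (≡.sym (injective (there x∈p) here f[1+x]≡f₀)))

⊂-minimal : ∀ {ℓ} {P : Subset k → Set ℓ} → Decidable P → P X →
            ∃[ Y ] Y ⊆ X × P Y × (∀ Z → Z ⊂ Y → ¬ P Z)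
⊂-minimal {X = X} {P = P} P? = go (⊂-wellFounded X)
  where
  go : ∀ {X} → Acc _⊂_ X → P X → ∃[ Y ] Y ⊆ X × P Y × (∀ Z → Z ⊂ Y → ¬ P Z)
  go {X} (acc smaller) PX with anySubset? (λ Z → Z ⊂? X ×-dec P? Z)
  ... | no none = X , ⊆-refl , PX , λ Z Z⊂X PZ → none (Z , Z⊂X , PZ)
  ... | yes (Z , Z⊂X@(Z⊆X , _) , PZ) with go (smaller Z⊂X) PZ
  ...   | Y , Y⊆Z , PY , minimal = Y , Z⊆X ∘ Y⊆Z , PY , minimal

∈-tabulate⁺ : ∀ {f : Fin k → Bool} → f x ≡ true → x ∈ tabulate f
∈-tabulate⁺ {x = x} {f = f} fx≡true =
  lookup⇒[]= x (tabulate f) (trans (lookup∘tabulate f x) fx≡true)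

∈-tabulate⁻ : ∀ {f : Fin k → Bool} → x ∈ tabulate f → f x ≡ true
∈-tabulate⁻ {x = x} {f = f} x∈ = trans (≡.sym (lookup∘tabulate f x)) ([]=⇒lookup x∈)

-- Hall's theorem

module _ (R : Fin k → Fin k → Bool) where

  -- For R = adj G this is N G, definitionally.
  neighbours : Subset k → Subset k
  neighbours S = tabulate λ y → any (λ x → lookup S x ∧ R x y) (allFin k)

  ∈neighbours⁺ : x ∈ S → R x y ≡ true → y ∈ neighbours S
  ∈neighbours⁺ {x = x} x∈S Rxy = ∈-tabulate⁺ (Equivalence.to T-≡ (any⁺ _
    (lose (∈-allFin x) (Equivalence.from T-≡ (cong₂ _∧_ ([]=⇒lookup x∈S) Rxy)))))

  ∈neighbours⁻ : y ∈ neighbours S → ∃[ x ] x ∈ S × R x y ≡ true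
  ∈neighbours⁻ {S = S} y∈NS
    with satisfied (any⁻ _ (allFin k) (Equivalence.from T-≡ (∈-tabulate⁻ y∈NS)))
  ... | x , T[Sx∧Rxy] with Equivalence.to T-∧ T[Sx∧Rxy]
  ...   | T[Sx] , T[Rxy] =
    x , lookup⇒[]= x S (Equivalence.to T-≡ T[Sx]) , Equivalence.to T-≡ T[Rxy]

  neighbours-mono : S ⊆ T → neighbours S ⊆ neighbours T
  neighbours-mono S⊆T y∈NS with ∈neighbours⁻ y∈NS
  ... | x , x∈S , Rxy = ∈neighbours⁺ (S⊆T x∈S) Rxy

  ∈neighbours⁅⁆⁻ : y ∈ neighbours ⁅ x ⁆ → R x y ≡ true
  ∈neighbours⁅⁆⁻ {y = y} {x = x} y∈N⁅x⁆ with ∈neighbours⁻ y∈N⁅x⁆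
  ... | x′ , x′∈⁅x⁆ , Rx′y = ≡.subst (λ x′ → R x′ y ≡ true) (x∈⁅y⁆⇒x≡y x x′∈⁅x⁆) Rx′y

  HallCondition : Subset k → Subset k → Set
  HallCondition X Y = ∀ S → S ⊆ X → ∣ S ∣ ≤ ∣ Y ∩ neighbours S ∣

  record SaturatingMatching (X Y : Subset k) : Set where
    field
      partner   : Fin k → Fin k
      partner∈  : x ∈ X → partner x ∈ Y
      related   : x ∈ X → R x (partner x) ≡ true
      injective : x ∈ X → y ∈ X → partner x ≡ partner y → x ≡ y

  open SaturatingMatching

  saturating-mono : S ⊆ X → Y ⊆ T → SaturatingMatching X Y → SaturatingMatching S T
  saturating-mono S⊆X Y⊆T σ = record
    { partner   = partner σ
    ; partner∈  = Y⊆T ∘ partner∈ σ ∘ S⊆X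
    ; related   = related σ ∘ S⊆X
    ; injective = λ x∈S y∈S → injective σ (S⊆X x∈S) (S⊆X y∈S)
    }

  saturating-∅ : Empty X → SaturatingMatching X Y
  saturating-∅ empty = record
    { partner   = λ x → x
    ; partner∈  = λ x∈X → contradiction (_ , x∈X) empty
    ; related   = λ x∈X → contradiction (_ , x∈X) empty
    ; injective = λ x∈X _ _ → contradiction (_ , x∈X) empty
    }

  saturating-⁅⁆ : R x y ≡ true → SaturatingMatching ⁅ x ⁆ ⁅ y ⁆
  saturating-⁅⁆ {x = x} {y = y} Rxy = record
    { partner   = λ _ → y
    ; partner∈  = λ _ → x∈⁅x⁆ y
    ; related   = λ x'∈⁅x⁆ → ≡.subst (λ x' → R x' y ≡ true) (≡.sym (x∈⁅y⁆⇒x≡y x x'∈⁅x⁆)) Rxy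
    ; injective = λ x₁∈⁅x⁆ x₂∈⁅x⁆ _ → trans (x∈⁅y⁆⇒x≡y x x₁∈⁅x⁆) (≡.sym (x∈⁅y⁆⇒x≡y x x₂∈⁅x⁆))
    }

  module _ {X₁ X₂ Y₁ Y₂ : Subset k}
           (σ₁ : SaturatingMatching X₁ Y₁) (σ₂ : SaturatingMatching X₂ Y₂)
           (disjoint : ∀ {y} → y ∈ Y₁ → y ∉ Y₂) where

    private
      choose : ∀ x → Dec (x ∈ X₁) → Fin k
      choose x (yes _) = partner σ₁ x
      choose x (no _)  = partner σ₂ x

      ∈X₂ : x ∈ X₁ ∪ X₂ → x ∉ X₁ → x ∈ X₂
      ∈X₂ {x = x} x∈X₁∪X₂ x∉X₁ with x∈p∪q⁻ X₁ X₂ x∈X₁∪X₂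
      ... | inj₁ x∈X₁ = contradiction x∈X₁ x∉X₁
      ... | inj₂ x∈X₂ = x∈X₂

      choose∈ : x ∈ X₁ ∪ X₂ → ∀ d → choose x d ∈ Y₁ ∪ Y₂
      choose∈ _        (yes x∈X₁) = x∈p∪q⁺ (inj₁ (partner∈ σ₁ x∈X₁))
      choose∈ x∈X₁∪X₂ (no x∉X₁)  = x∈p∪q⁺ (inj₂ (partner∈ σ₂ (∈X₂ x∈X₁∪X₂ x∉X₁)))

      choose-related : x ∈ X₁ ∪ X₂ → ∀ d → R x (choose x d) ≡ true
      choose-related _        (yes x∈X₁) = related σ₁ x∈X₁
      choose-related x∈X₁∪X₂ (no x∉X₁)  = related σ₂ (∈X₂ x∈X₁∪X₂ x∉X₁)

      choose-injective : x ∈ X₁ ∪ X₂ → y ∈ X₁ ∪ X₂ → ∀ d e → choose x d ≡ choose y e → x ≡ y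
      choose-injective _   _   (yes x∈X₁) (yes y∈X₁) = injective σ₁ x∈X₁ y∈X₁
      choose-injective x∈X y∈X (no x∉X₁)  (no y∉X₁)  = injective σ₂ (∈X₂ x∈X x∉X₁) (∈X₂ y∈X y∉X₁)
      choose-injective _   y∈X (yes x∈X₁) (no y∉X₁)  σ₁x≡σ₂y =
        contradiction (≡.subst (_∈ Y₂) (≡.sym σ₁x≡σ₂y) (partner∈ σ₂ (∈X₂ y∈X y∉X₁)))
                      (disjoint (partner∈ σ₁ x∈X₁))
      choose-injective x∈X _   (no x∉X₁)  (yes y∈X₁) σ₂x≡σ₁y =
        contradiction (≡.subst (_∈ Y₂) σ₂x≡σ₁y (partner∈ σ₂ (∈X₂ x∈X x∉X₁)))
                      (disjoint (partner∈ σ₁ y∈X₁))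

    saturating-∪ : SaturatingMatching (X₁ ∪ X₂) (Y₁ ∪ Y₂)
    saturating-∪ = record
      { partner   = λ x → choose x (x ∈? X₁)
      ; partner∈  = λ {x} x∈X → choose∈ x∈X (x ∈? X₁)
      ; related   = λ {x} x∈X → choose-related x∈X (x ∈? X₁)
      ; injective = λ {x} {y} x∈X y∈X → choose-injective x∈X y∈X (x ∈? X₁) (y ∈? X₁)
      }

  Tight : Subset k → Subset k → Subset k → Set
  Tight X Y S = Nonempty S × S ⊂ X × ∣ Y ∩ neighbours S ∣ ≤ ∣ S ∣

  tight? : ∀ X Y S → Dec (Tight X Y S)
  tight? X Y S = nonempty? S ×-dec S ⊂? X ×-dec ∣ Y ∩ neighbours S ∣ ≤? ∣ S ∣

  hallCondition-tight : HallCondition X Y → S ⊆ X → HallCondition S (Y ∩ neighbours S)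
  hallCondition-tight {Y = Y} {S = S} hallXY S⊆X T T⊆S =
    ≤-trans (hallXY T (S⊆X ∘ T⊆S)) (p⊆q⇒∣p∣≤∣q∣ narrow)
    where
    narrow : Y ∩ neighbours T ⊆ (Y ∩ neighbours S) ∩ neighbours T
    narrow y∈ with x∈p∩q⁻ Y (neighbours T) y∈
    ... | y∈Y , y∈NT = x∈p∩q⁺ (x∈p∩q⁺ (y∈Y , neighbours-mono T⊆S y∈NT) , y∈NT)

  hallCondition-complement : HallCondition X Y → S ⊆ X → ∣ Y ∩ neighbours S ∣ ≤ ∣ S ∣ →
                             HallCondition (X ─ S) (Y ─ neighbours S)
  hallCondition-complement {X = X} {Y = Y} {S = S} hallXY S⊆X tight T T⊆X─S =
    +-cancelʳ-≤ (∣ S ∣) (∣ T ∣) _ (begin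
      ∣ T ∣ + ∣ S ∣                                  ≤⟨ disjoint⇒∣p∣+∣q∣≤∣r∣ (p⊆p∪q S) (q⊆p∪q T S) T∩S≡∅ ⟩
      ∣ T ∪ S ∣                                      ≤⟨ hallXY (T ∪ S) T∪S⊆X ⟩
      ∣ Y ∩ neighbours (T ∪ S) ∣                     ≤⟨ p⊆q∪r⇒∣p∣≤∣q∣+∣r∣ split ⟩
      ∣ (Y ─ NS) ∩ neighbours T ∣ + ∣ Y ∩ NS ∣       ≤⟨ +-monoʳ-≤ _ tight ⟩
      ∣ (Y ─ NS) ∩ neighbours T ∣ + ∣ S ∣            ∎)
    where
    open ≤-Reasoning
    NS = neighbours S
    T∩S≡∅ : x ∈ T → x ∉ S
    T∩S≡∅ x∈T = x∈p─q⇒x∉q X S (T⊆X─S x∈T)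
    T∪S⊆X : T ∪ S ⊆ X
    T∪S⊆X = p⊆r∧q⊆r⇒p∪q⊆r (p─q⊆p X S ∘ T⊆X─S) S⊆X
    split : Y ∩ neighbours (T ∪ S) ⊆ (Y ─ NS) ∩ neighbours T ∪ Y ∩ NS
    split {y} y∈ with x∈p∩q⁻ Y _ y∈ | y ∈? NS
    ... | y∈Y , _        | yes y∈NS = x∈p∪q⁺ (inj₂ (x∈p∩q⁺ (y∈Y , y∈NS)))
    ... | y∈Y , y∈N[T∪S] | no y∉NS with ∈neighbours⁻ y∈N[T∪S]
    ...   | x , x∈T∪S , Rxy with x∈p∪q⁻ T S x∈T∪S
    ...     | inj₁ x∈T = x∈p∪q⁺ (inj₁ (x∈p∩q⁺ (x∈p∧x∉q⇒x∈p─q y∈Y y∉NS , ∈neighbours⁺ x∈T Rxy)))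
    ...     | inj₂ x∈S = contradiction (∈neighbours⁺ x∈S Rxy) y∉NS

  hallCondition-delete : HallCondition X Y → (∀ S → ¬ Tight X Y S) → x ∈ X →
                         HallCondition (X - x) (Y - y)
  hallCondition-delete {X = X} {Y = Y} {x = x} {y = y} hallXY loose x∈X S S⊆X-x
    with nonempty? S
  ... | no empty = ≤-trans (≤-reflexive (Empty⇒∣p∣≡0 S empty)) z≤n
  ... | yes S≢∅ = s≤s⁻¹ (begin-strict
      ∣ S ∣                     <⟨ ≰⇒> (λ ∣NS∣≤∣S∣ → loose S (S≢∅ , S⊂X , ∣NS∣≤∣S∣)) ⟩
      ∣ Y ∩ NS ∣                ≤⟨ ∣p∣≤1+∣p-x∣ (Y ∩ NS) y ⟩
      suc ∣ Y ∩ NS - y ∣        ≤⟨ s≤s (p⊆q⇒∣p∣≤∣q∣ (p∩q-x⊆[p-x]∩q Y NS y)) ⟩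
      suc ∣ (Y - y) ∩ NS ∣      ∎)
    where
    open ≤-Reasoning
    NS = neighbours S
    S⊂X : S ⊂ X
    S⊂X = p─q⊆p X ⁅ x ⁆ ∘ S⊆X-x , x , x∈X , x∉p-x ∘ S⊆X-x

  private
    InductionHypothesis : Subset k → Set
    InductionHypothesis X = ∀ {X′} → X′ ⊂ X → ∀ Y → HallCondition X′ Y → SaturatingMatching X′ Y

    hall-tight : InductionHypothesis X → HallCondition X Y → Tight X Y S → SaturatingMatching X Y
    hall-tight {X = X} {Y = Y} {S = S} ih hallXY ((z , z∈S) , S⊂X@(S⊆X , _) , tight) =
      saturating-mono (p⊆q∪p─q X S) (p⊆r∧q⊆r⇒p∪q⊆r (p∩q⊆p Y NS) (p─q⊆p Y NS))
        (saturating-∪ (ih S⊂X (Y ∩ NS) (hallCondition-tight {Y = Y} hallXY S⊆X))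
                      (ih X─S⊂X (Y ─ NS) (hallCondition-complement {Y = Y} hallXY S⊆X tight))
                      (λ y∈Y∩NS y∈Y─NS → x∈p─q⇒x∉q Y NS y∈Y─NS (proj₂ (x∈p∩q⁻ Y NS y∈Y∩NS))))
      where
      NS = neighbours S
      X─S⊂X : X ─ S ⊂ X
      X─S⊂X = p∩q≢∅⇒p─q⊂p X S (z , x∈p∩q⁺ (S⊆X z∈S , z∈S))

    hall-loose : InductionHypothesis X → HallCondition X Y → (∀ S → ¬ Tight X Y S) → x ∈ X →
                 SaturatingMatching X Y
    hall-loose {X = X} {Y = Y} {x = x} ih hallXY loose x∈X
      with ∣p∣>0⇒Nonempty (Y ∩ neighbours ⁅ x ⁆) Y∩N⁅x⁆≢∅
      where
      Y∩N⁅x⁆≢∅ : 0 < ∣ Y ∩ neighbours ⁅ x ⁆ ∣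
      Y∩N⁅x⁆≢∅ = ≤-trans (≤-reflexive (≡.sym (∣⁅x⁆∣≡1 x))) (hallXY ⁅ x ⁆ (x∈p⇒⁅x⁆⊆p x∈X))
    ... | y , y∈Y∩N⁅x⁆ with x∈p∩q⁻ Y _ y∈Y∩N⁅x⁆
    ...   | y∈Y , y∈N⁅x⁆ =
      saturating-mono (p⊆q∪p─q X ⁅ x ⁆) (p⊆r∧q⊆r⇒p∪q⊆r (x∈p⇒⁅x⁆⊆p y∈Y) (p─q⊆p Y ⁅ y ⁆))
        (saturating-∪ (saturating-⁅⁆ (∈neighbours⁅⁆⁻ y∈N⁅x⁆))
                      (ih (x∈p⇒p-x⊂p x∈X) (Y - y) (hallCondition-delete {Y = Y} hallXY loose x∈X))
                      (λ z∈⁅y⁆ → ≡.subst (_∉ Y - y) (≡.sym (x∈⁅y⁆⇒x≡y y z∈⁅y⁆)) x∉p-x))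

  -- Induction on X: split X along a tight set if there is one; otherwise every
  -- nonempty S ⊂ X has a neighbour to spare, so any edge from X into Y can be used.
  hall : HallCondition X Y → SaturatingMatching X Y
  hall {X = X} = go (⊂-wellFounded X) _
    where
    go : ∀ {X} → Acc _⊂_ X → ∀ Y → HallCondition X Y → SaturatingMatching X Y
    go {X} (acc smaller) Y hallXY with anySubset? (tight? X Y) | nonempty? X
    ... | yes (_ , tight) | _              = hall-tight (go ∘ smaller) hallXY tight
    ... | no loose        | yes (_ , x∈X)  = hall-loose (go ∘ smaller) hallXY (λ S → loose ∘ (S ,_)) x∈X
    ... | no _            | no empty       = saturating-∅ empty

-- Critical sets

+m-+n≤+o-+p⇔m+p≤o+n : ∀ m n o p → (ℤ.+ m ℤ.- ℤ.+ n ℤ.≤ ℤ.+ o ℤ.- ℤ.+ p) ⇔ (m + p ≤ o + n)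
+m-+n≤+o-+p⇔m+p≤o+n m n o p = mk⇔ to from
  where
  open import Data.Integer using (+_) renaming (_+_ to _⊕_; _-_ to _⊝_)
  shift₁ : ∀ i j l → i ⊝ j ⊕ (j ⊕ l) ≡ i ⊕ l
  shift₁ = ℤ-Solver.solve-∀
  shift₂ : ∀ i j l → i ⊝ l ⊕ (j ⊕ l) ≡ i ⊕ j
  shift₂ = ℤ-Solver.solve-∀
  unshift₁ : ∀ i j l → i ⊕ l ⊝ (j ⊕ l) ≡ i ⊝ j
  unshift₁ = ℤ-Solver.solve-∀
  unshift₂ : ∀ i j l → i ⊕ j ⊝ (j ⊕ l) ≡ i ⊝ l
  unshift₂ = ℤ-Solver.solve-∀
  to : + m ⊝ + n ℤ.≤ + o ⊝ + p → m + p ≤ o + n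
  to h = ℤ.drop‿+≤+ (≡.subst₂ ℤ._≤_
    (trans (shift₁ (+ m) (+ n) (+ p)) (≡.sym (ℤ.pos-+ m p)))
    (trans (shift₂ (+ o) (+ n) (+ p)) (≡.sym (ℤ.pos-+ o n)))
    (ℤ.+-monoˡ-≤ (+ n ⊕ + p) h))
  from : m + p ≤ o + n → + m ⊝ + n ℤ.≤ + o ⊝ + p
  from h = ≡.subst₂ ℤ._≤_
    (trans (cong (_⊝ (+ n ⊕ + p)) (ℤ.pos-+ m p)) (unshift₁ (+ m) (+ n) (+ p)))
    (trans (cong (_⊝ (+ n ⊕ + p)) (ℤ.pos-+ o n)) (unshift₂ (+ o) (+ n) (+ p)))
    (ℤ.+-monoˡ-≤ (ℤ.- (+ n ⊕ + p)) (ℤ.+≤+ h))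

adj-sym : (G : Graph) {x y : Fin (n G)} → adj G x y ≡ true → adj G y x ≡ true
adj-sym G {x} {y} = trans (sym G y x)

module _ (G : Graph) where

  private
    variable
      J : Subset (n G)

  surplus≤surplus⇔ : ∀ S T → (surplus G S ℤ.≤ surplus G T) ⇔ (∣ S ∣ + ∣ N G T ∣ ≤ ∣ T ∣ + ∣ N G S ∣)
  surplus≤surplus⇔ S T = +m-+n≤+o-+p⇔m+p≤o+n (∣ S ∣) (∣ N G S ∣) (∣ T ∣) (∣ N G T ∣)

  ∣S∣+∣N[J─N[S]]∣≤∣N[J]∣ : S ⊆ N G J → ∣ S ∣ + ∣ N G (J ─ N G S) ∣ ≤ ∣ N G J ∣
  ∣S∣+∣N[J─N[S]]∣≤∣N[J]∣ {S = S} {J = J} S⊆NJ =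
    disjoint⇒∣p∣+∣q∣≤∣r∣ S⊆NJ (neighbours-mono (adj G) (p─q⊆p J (N G S))) S∩N[J─N[S]]≡∅
    where
    S∩N[J─N[S]]≡∅ : y ∈ S → y ∉ N G (J ─ N G S)
    S∩N[J─N[S]]≡∅ y∈S y∈N[J─NS] with ∈neighbours⁻ (adj G) y∈N[J─NS]
    ... | x , x∈J─NS , Axy = x∈p─q⇒x∉q J (N G S) x∈J─NS (∈neighbours⁺ (adj G) y∈S (adj-sym G Axy))

  -- That is, surplus J + ∣S∣ ≤ surplus (J ─ N S) + ∣J ∩ N S∣, written without subtraction.
  removing-neighbours : S ⊆ N G J →
    ∣ J ∣ + ∣ N G (J ─ N G S) ∣ + ∣ S ∣ ≤ ∣ J ─ N G S ∣ + ∣ N G J ∣ + ∣ J ∩ N G S ∣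
  removing-neighbours {S = S} {J = J} S⊆NJ = begin
    ∣ J ∣ + ∣ N G J─NS ∣ + ∣ S ∣
      ≡⟨ cong (λ j → j + ∣ N G J─NS ∣ + ∣ S ∣) (∣p∣≡∣p∩q∣+∣p─q∣ J (N G S)) ⟩
    ∣ J∩NS ∣ + ∣ J─NS ∣ + ∣ N G J─NS ∣ + ∣ S ∣
      ≡⟨ shuffle (∣ J∩NS ∣) (∣ J─NS ∣) (∣ N G J─NS ∣) (∣ S ∣) ⟩
    ∣ J─NS ∣ + (∣ S ∣ + ∣ N G J─NS ∣) + ∣ J∩NS ∣
      ≤⟨ +-monoˡ-≤ (∣ J∩NS ∣) (+-monoʳ-≤ (∣ J─NS ∣) (∣S∣+∣N[J─N[S]]∣≤∣N[J]∣ {J = J} S⊆NJ)) ⟩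
    ∣ J─NS ∣ + ∣ N G J ∣ + ∣ J∩NS ∣
      ∎
    where
    open ≤-Reasoning
    J─NS = J ─ N G S
    J∩NS = J ∩ N G S
    shuffle : ∀ t j ν s → t + j + ν + s ≡ j + (s + ν) + t
    shuffle = solve-∀

  critical⇒hallCondition : ∀ J → IsMaxSurplus G J → HallCondition (adj G) (N G J) J
  critical⇒hallCondition J critical S S⊆NJ =
    +-cancelˡ-≤ (∣ J ∣ + ∣ N G J─NS ∣) (∣ S ∣) _
      (≤-trans (removing-neighbours {J = J} S⊆NJ)
               (+-monoˡ-≤ _ (Equivalence.to (surplus≤surplus⇔ J─NS J) (critical J─NS))))
    where J─NS = J ─ N G S

  minimalCritical⇒hallCondition : ∀ J → IsMaxSurplus G J →
                                  (∀ T → T ⊂ J → ¬ surplus G J ℤ.≤ surplus G T) →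
                                  x ∈ J → HallCondition (adj G) (N G J) (J - x)
  minimalCritical⇒hallCondition {x = x} J critical minimal x∈J S S⊆NJ with x ∈? N G S
  ... | no x∉NS = begin
    ∣ S ∣                  ≤⟨ critical⇒hallCondition J critical S S⊆NJ ⟩
    ∣ J ∩ N G S ∣          ≤⟨ p⊆q⇒∣p∣≤∣q∣ (p∩q-x⊆[p-x]∩q J (N G S) x ∘ x∉p⇒p⊆p-x x∉J∩NS) ⟩
    ∣ (J - x) ∩ N G S ∣    ∎
    where
    open ≤-Reasoning
    x∉J∩NS : x ∉ J ∩ N G S
    x∉J∩NS = x∉NS ∘ proj₂ ∘ x∈p∩q⁻ J (N G S)
  ... | yes x∈NS = s≤s⁻¹ (begin-strict
    ∣ S ∣                      <⟨ +-cancelˡ-< (∣ J ∣ + ∣ N G J─NS ∣) (∣ S ∣) _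
                                    (≤-<-trans (removing-neighbours {J = J} S⊆NJ) (+-monoˡ-< _ J─NS-worse)) ⟩
    ∣ J ∩ N G S ∣              ≤⟨ ∣p∣≤1+∣p-x∣ (J ∩ N G S) x ⟩
    suc ∣ J ∩ N G S - x ∣      ≤⟨ s≤s (p⊆q⇒∣p∣≤∣q∣ (p∩q-x⊆[p-x]∩q J (N G S) x)) ⟩
    suc ∣ (J - x) ∩ N G S ∣    ∎)
    where
    open ≤-Reasoning
    J─NS = J ─ N G S
    J─NS⊂J : J─NS ⊂ J
    J─NS⊂J = p─q⊆p J (N G S) , x , x∈J , λ x∈J─NS → x∈p─q⇒x∉q J (N G S) x∈J─NS x∈NS
    J─NS-worse : ∣ J─NS ∣ + ∣ N G J ∣ < ∣ J ∣ + ∣ N G J─NS ∣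
    J─NS-worse = ≰⇒> (minimal J─NS J─NS⊂J ∘ Equivalence.from (surplus≤surplus⇔ J J─NS))

-- Matchings

module _ {G : Graph} where

  Covered : Matching G → Subset (n G)
  Covered M = tabulate λ x → is-just (mate M x)

  ∈Covered⁺ : ∀ (M : Matching G) → mate M x ≡ just y → x ∈ Covered M
  ∈Covered⁺ M Mx≡y = ∈-tabulate⁺ (cong is-just Mx≡y)

  ∈Covered⁻ : ∀ (M : Matching G) → x ∈ Covered M → ∃[ y ] mate M x ≡ just y
  ∈Covered⁻ {x = x} M x∈C with mate M x | ∈-tabulate⁻ {f = is-just ∘ mate M} x∈C
  ... | just y | _ = y , refl

  mate-injective : ∀ (M : Matching G) → mate M x ≡ just z → mate M y ≡ just z → x ≡ y
  mate-injective {x = x} {z = z} {y = y} M Mx≡z My≡z =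
    just-injective (trans (≡.sym (mate-sym M x z Mx≡z)) (mate-sym M y z My≡z))

  module _ (M₁ M₂ : Matching G) (disjoint : ∀ {x} → x ∈ Covered M₁ → x ∉ Covered M₂) where

    private
      mate₁₂ : Fin (n G) → Maybe (Fin (n G))
      mate₁₂ x = mate M₁ x <∣> mate M₂ x

      adj₁₂ : ∀ x y → mate₁₂ x ≡ just y → adj G x y ≡ true
      adj₁₂ x y M₁₂x≡y with mate M₁ x in M₁x
      ... | just _  = mate-adj M₁ x y (trans M₁x M₁₂x≡y)
      ... | nothing = mate-adj M₂ x y M₁₂x≡y

      sym₁₂ : ∀ x y → mate₁₂ x ≡ just y → mate₁₂ y ≡ just x
      sym₁₂ x y M₁₂x≡y with mate M₁ x in M₁x
      ... | just _ rewrite mate-sym M₁ x y (trans M₁x M₁₂x≡y) = refl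
      ... | nothing with mate M₁ y in M₁y
      ...   | just _  = contradiction (∈Covered⁺ M₂ (mate-sym M₂ x y M₁₂x≡y)) (disjoint (∈Covered⁺ M₁ M₁y))
      ...   | nothing = mate-sym M₂ x y M₁₂x≡y

    _∪ᴹ_ : Matching G
    _∪ᴹ_ = record { mate = mate₁₂ ; mate-adj = adj₁₂ ; mate-sym = sym₁₂ }

    covered-∪ᴹ : covered G M₁ + covered G M₂ ≤ covered G _∪ᴹ_
    covered-∪ᴹ = disjoint⇒∣p∣+∣q∣≤∣r∣ C₁⊆C₁₂ C₂⊆C₁₂ disjoint
      where
      C₁⊆C₁₂ : Covered M₁ ⊆ Covered _∪ᴹ_
      C₁⊆C₁₂ {x} x∈C₁ with ∈Covered⁻ M₁ x∈C₁
      ... | y , M₁x≡y = ∈Covered⁺ _∪ᴹ_ (cong (_<∣> mate M₂ x) M₁x≡y)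
      C₂⊆C₁₂ : Covered M₂ ⊆ Covered _∪ᴹ_
      C₂⊆C₁₂ {x} x∈C₂ with ∈Covered⁻ M₂ x∈C₂ | mate M₁ x in M₁x
      ... | _ , _      | just _  = contradiction x∈C₂ (disjoint (∈Covered⁺ M₁ M₁x))
      ... | y , M₂x≡y | nothing = ∈Covered⁺ _∪ᴹ_ (trans (cong (_<∣> mate M₂ x) M₁x) M₂x≡y)

  module _ (M : Matching G) (H : Subset (n G)) where

    private
      within : Fin (n G) → Maybe (Fin (n G))
      within y = if does (y ∈? H) then just y else nothing

      mateᴴ : Fin (n G) → Maybe (Fin (n G))
      mateᴴ x = if does (x ∈? H) then mate M x >>= within else nothing

      mateᴴ-just⁻ : mateᴴ x ≡ just y → mate M x ≡ just y × x ∈ H × y ∈ H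
      mateᴴ-just⁻ {x = x} Mᴴx≡y with x ∈? H | mate M x
      ... | yes x∈H | just z with z ∈? H
      ...   | yes z∈H with refl ← Mᴴx≡y = refl , x∈H , z∈H

      mateᴴ-just⁺ : mate M x ≡ just y → x ∈ H → y ∈ H → mateᴴ x ≡ just y
      mateᴴ-just⁺ {x = x} {y = y} Mx≡y x∈H y∈H
        rewrite dec-true (x ∈? H) x∈H | Mx≡y | dec-true (y ∈? H) y∈H = refl

    _↾_ : Matching G
    _↾_ = record
      { mate     = mateᴴ
      ; mate-adj = λ x y Mᴴx≡y → mate-adj M x y (proj₁ (mateᴴ-just⁻ Mᴴx≡y))
      ; mate-sym = λ x y Mᴴx≡y → let Mx≡y , x∈H , y∈H = mateᴴ-just⁻ Mᴴx≡y
                                 in mateᴴ-just⁺ (mate-sym M x y Mx≡y) y∈H x∈H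
      }

    ↾-unmatched : x ∉ H → mate _↾_ x ≡ nothing
    ↾-unmatched {x = x} x∉H rewrite dec-false (x ∈? H) x∉H = refl

    Covered-↾ : Covered _↾_ ⊆ H
    Covered-↾ x∈C with ∈Covered⁻ _↾_ x∈C
    ... | _ , Mᴴx≡y = proj₁ (proj₂ (mateᴴ-just⁻ Mᴴx≡y))

    ∈Covered-↾⁺ : mate M x ≡ just y → x ∈ H → y ∈ H → x ∈ Covered _↾_
    ∈Covered-↾⁺ Mx≡y x∈H y∈H = ∈Covered⁺ _↾_ (mateᴴ-just⁺ Mx≡y x∈H y∈H)

  module _ {X Y : Subset (n G)} (X∩Y≡∅ : ∀ {x} → x ∈ X → x ∉ Y)
           (σ : SaturatingMatching (adj G) X Y) where

    open SaturatingMatching σ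

    private
      preimage : Fin (n G) → Maybe (Fin (n G))
      preimage y with any? (λ x → x ∈? X ×-dec partner x ≟ᶠ y)
      ... | yes (x , _) = just x
      ... | no _        = nothing

      preimage-just : preimage y ≡ just x → x ∈ X × partner x ≡ y
      preimage-just {y = y} eq with any? (λ x → x ∈? X ×-dec partner x ≟ᶠ y)
      preimage-just refl | yes (_ , x∈X , σx≡y) = x∈X , σx≡y

      preimage-partner : x ∈ X → preimage (partner x) ≡ just x
      preimage-partner {x = x} x∈X with any? (λ x′ → x′ ∈? X ×-dec partner x′ ≟ᶠ partner x)
      ... | yes (x′ , x′∈X , σx′≡σx) = cong just (injective x′∈X x∈X σx′≡σx)
      ... | no none                  = contradiction (x , x∈X , refl) none

      preimage-nothing : (∀ {x} → x ∈ X → partner x ≢ y) → preimage y ≡ nothing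
      preimage-nothing {y = y} unhit with any? (λ x → x ∈? X ×-dec partner x ≟ᶠ y)
      ... | yes (_ , x∈X , σx≡y) = contradiction σx≡y (unhit x∈X)
      ... | no _                 = refl

      mateσ : Fin (n G) → Maybe (Fin (n G))
      mateσ x = if does (x ∈? X) then just (partner x) else preimage x

      mateσ-X : x ∈ X → mateσ x ≡ just (partner x)
      mateσ-X {x = x} x∈X rewrite dec-true (x ∈? X) x∈X = refl

      mateσ-∉X : x ∉ X → mateσ x ≡ preimage x
      mateσ-∉X {x = x} x∉X rewrite dec-false (x ∈? X) x∉X = refl

      partner∉X : x ∈ X → partner x ∉ X
      partner∉X x∈X σx∈X = X∩Y≡∅ σx∈X (partner∈ x∈X)

      mateσ-partner : x ∈ X → mateσ (partner x) ≡ just x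
      mateσ-partner x∈X = trans (mateσ-∉X (partner∉X x∈X)) (preimage-partner x∈X)

      adjσ : ∀ x y → mateσ x ≡ just y → adj G x y ≡ true
      adjσ x y Mx≡y with x ∈? X
      ... | yes x∈X = ≡.subst (λ y → adj G x y ≡ true) (just-injective Mx≡y) (related x∈X)
      ... | no _ with preimage-just Mx≡y
      ...   | y∈X , σy≡x = adj-sym G (≡.subst (λ x → adj G y x ≡ true) σy≡x (related y∈X))

      symσ : ∀ x y → mateσ x ≡ just y → mateσ y ≡ just x
      symσ x y Mx≡y with x ∈? X
      ... | yes x∈X with refl ← Mx≡y = mateσ-partner x∈X
      ... | no _ with preimage-just Mx≡y
      ...   | y∈X , σy≡x = trans (mateσ-X y∈X) (cong just σy≡x)

    fromSaturating : Matching G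
    fromSaturating = record { mate = mateσ ; mate-adj = adjσ ; mate-sym = symσ }

    Covered-fromSaturating : Covered fromSaturating ⊆ X ∪ Y
    Covered-fromSaturating {x} x∈C with x ∈? X | ∈Covered⁻ fromSaturating x∈C
    ... | yes x∈X | _ = x∈p∪q⁺ (inj₁ x∈X)
    ... | no _    | _ , Mx≡y with preimage-just Mx≡y
    ...   | y∈X , σy≡x = x∈p∪q⁺ (inj₂ (≡.subst (_∈ Y) σy≡x (partner∈ y∈X)))

    covered-fromSaturating : ∣ X ∣ + ∣ X ∣ ≤ covered G fromSaturating
    covered-fromSaturating = ≤-trans (+-monoʳ-≤ ∣ X ∣ ∣X∣≤∣C∩Y∣)
      (disjoint⇒∣p∣+∣q∣≤∣r∣ X⊆C (p∩q⊆p C Y) (λ x∈X x∈C∩Y → X∩Y≡∅ x∈X (proj₂ (x∈p∩q⁻ C Y x∈C∩Y))))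
      where
      C = Covered fromSaturating
      X⊆C : X ⊆ C
      X⊆C x∈X = ∈Covered⁺ fromSaturating (mateσ-X x∈X)
      ∣X∣≤∣C∩Y∣ : ∣ X ∣ ≤ ∣ C ∩ Y ∣
      ∣X∣≤∣C∩Y∣ = injectiveOn⇒∣p∣≤∣q∣ partner
        (λ x∈X → x∈p∩q⁺ (∈Covered⁺ fromSaturating (mateσ-partner x∈X) , partner∈ x∈X)) injective

    fromSaturating-unmatched : y ∈ Y → (∀ {x} → x ∈ X → partner x ≢ y) →
                               mate fromSaturating y ≡ nothing
    fromSaturating-unmatched y∈Y unhit =
      trans (mateσ-∉X (λ y∈X → X∩Y≡∅ y∈X y∈Y)) (preimage-nothing unhit)

vectors : ∀ {A : Set} → List A → (k : ℕ) → List (Vec A k)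
vectors xs zero    = [ [] ]
vectors xs (suc k) = cartesianProductWith _∷_ xs (vectors xs k)

∈-vectors : ∀ {A : Set} {xs : List A} → (∀ x → x ∈ˡ xs) → (v : Vec A k) → v ∈ˡ vectors xs k
∈-vectors all∈ []      = Any.here refl
∈-vectors all∈ (x ∷ v) = ∈-cartesianProductWith⁺ _∷_ (all∈ x) (∈-vectors all∈ v)

allMaybeFin : ∀ k → List (Maybe (Fin k))
allMaybeFin k = nothing ∷ map just (allFin k)

∈-allMaybeFin : ∀ (i : Maybe (Fin k)) → i ∈ˡ allMaybeFin k
∈-allMaybeFin nothing  = Any.here refl
∈-allMaybeFin (just x) = Any.there (∈-map⁺ just (∈-allFin x))

module _ (G : Graph) where

  private
    mutualMate : (Fin (n G) → Maybe (Fin (n G))) → Fin (n G) → Maybe (Fin (n G))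
    mutualMate m x = m x >>= λ y →
      if adj G x y ∧ does (≡-decᵐ _≟ᶠ_ (m y) (just x)) then just y else nothing

    mutualMate-just⁻ : ∀ m → mutualMate m x ≡ just y →
                       m x ≡ just y × adj G x y ≡ true × m y ≡ just x
    mutualMate-just⁻ {x = x} m eq with m x
    ... | just z with adj G x z in Axz | ≡-decᵐ _≟ᶠ_ (m z) (just x)
    ...   | true | yes mz≡x with refl ← eq = refl , Axz , mz≡x

    mutualMate-just⁺ : ∀ m → m x ≡ just y → adj G x y ≡ true → m y ≡ just x →
                       mutualMate m x ≡ just y
    mutualMate-just⁺ {x = x} {y = y} m mx≡y Axy my≡x
      rewrite mx≡y | Axy | dec-true (≡-decᵐ _≟ᶠ_ (m y) (just x)) my≡x = refl

  -- Every candidate mate function gives a matching by keeping its mutual adjacent pairs,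
  -- so a maximum matching is an argmax over all candidate vectors.
  mutualPairs : (Fin (n G) → Maybe (Fin (n G))) → Matching G
  mutualPairs m = record
    { mate     = mutualMate m
    ; mate-adj = λ x y eq → proj₁ (proj₂ (mutualMate-just⁻ m eq))
    ; mate-sym = λ x y eq → let mx≡y , Axy , my≡x = mutualMate-just⁻ m eq
                            in mutualMate-just⁺ m my≡x (adj-sym G Axy) mx≡y
    }

  covered-mutualPairs : ∀ (M : Matching G) {m} → (∀ x → m x ≡ mate M x) →
                        covered G (mutualPairs m) ≡ covered G M
  covered-mutualPairs M {m} m≗M = cong ∣_∣ (tabulate-cong λ x → cong is-just (same-mate x))
    where
    same-mate : ∀ x → mutualMate m x ≡ mate M x
    same-mate x with mate M x in Mx
    ... | just y  =
      mutualMate-just⁺ m (trans (m≗M x) Mx) (mate-adj M x y Mx) (trans (m≗M y) (mate-sym M x y Mx))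
    ... | nothing rewrite trans (m≗M x) Mx = refl

  maximumMatching : Σ (Matching G) (IsMaximumMatching G)
  maximumMatching = mutualPairs (lookup best) , λ M → begin
    covered G M                ≡⟨ ≡.sym (covered-mutualPairs M (lookup∘tabulate (mate M))) ⟩
    score (tabulate (mate M))  ≤⟨ All.lookup (f[xs]≤f[argmax] {f = score} (replicate _ nothing) candidates)
                                             (∈-vectors ∈-allMaybeFin (tabulate (mate M))) ⟩
    score best                 ∎
    where
    open ≤-Reasoning
    candidates = vectors (allMaybeFin (n G)) (n G)
    score : Vec (Maybe (Fin (n G))) (n G) → ℕ
    score v = covered G (mutualPairs (lookup v))
    best = argmax score (replicate _ nothing) candidates

-- Exchanging a matching near an independent set

-- Since J is independent, an M-covered vertex outside N(J) that is not matched inside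
-- H = ∁ (N(J) ∪ J) has its M-partner in N(J); counting such vertices gives
-- covered M + ∣N J∣ ≤ covered augmented + ∣Covered M ∩ N J∣.
module Augmentation {G : Graph} {J : Subset (n G)} (J-independent : Independent G J)
                    (σ : SaturatingMatching (adj G) (N G J) J) (M : Matching G) where

  private
    K = N G J
    H = ∁ (K ∪ J)
    C = Covered M

    K∩J≡∅ : x ∈ K → x ∉ J
    K∩J≡∅ {x = x} x∈K x∈J with ∈neighbours⁻ (adj G) x∈K
    ... | u , u∈J , Aux = contradiction (trans (≡.sym Aux) (J-independent u x u∈J x∈J)) λ ()

    ∈H : x ∉ K → x ∉ J → x ∈ H
    ∈H x∉K x∉J = x∉p⇒x∈∁p λ x∈K∪J → case x∈p∪q⁻ K J x∈K∪J of λ where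
      (inj₁ x∈K) → x∉K x∈K
      (inj₂ x∈J) → x∉J x∈J

    Mσ : Matching G
    Mσ = fromSaturating K∩J≡∅ σ

    Mᴴ : Matching G
    Mᴴ = M ↾ H

    Cσ∩Cᴴ≡∅ : x ∈ Covered Mσ → x ∉ Covered Mᴴ
    Cσ∩Cᴴ≡∅ x∈Cσ x∈Cᴴ = x∈∁p⇒x∉p (Covered-↾ M H x∈Cᴴ) (Covered-fromSaturating K∩J≡∅ σ x∈Cσ)

  augmented : Matching G
  augmented = (Mσ ∪ᴹ Mᴴ) Cσ∩Cᴴ≡∅

  private
    covered-augmented : ∣ K ∣ + ∣ K ∣ + covered G Mᴴ ≤ covered G augmented
    covered-augmented = ≤-trans (+-monoˡ-≤ (covered G Mᴴ) (covered-fromSaturating K∩J≡∅ σ))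
                                (covered-∪ᴹ Mσ Mᴴ Cσ∩Cᴴ≡∅)

    mate-∈K : x ∉ K → x ∉ Covered Mᴴ → mate M x ≡ just y → y ∈ K
    mate-∈K {x = x} {y = y} x∉K x∉Cᴴ Mx≡y with x ∈? J | y ∈? K | y ∈? J
    ... | yes x∈J | _       | _       = ∈neighbours⁺ (adj G) x∈J (mate-adj M x y Mx≡y)
    ... | no _    | yes y∈K | _       = y∈K
    ... | no _    | no _    | yes y∈J =
      contradiction (∈neighbours⁺ (adj G) y∈J (mate-adj M y x (mate-sym M x y Mx≡y))) x∉K
    ... | no x∉J  | no y∉K  | no y∉J  =
      contradiction (∈Covered-↾⁺ M H Mx≡y (∈H x∉K x∉J) (∈H y∉K y∉J)) x∉Cᴴ

    ∣C─K─Cᴴ∣≤∣C∩K∣ : ∣ C ─ K ─ Covered Mᴴ ∣ ≤ ∣ C ∩ K ∣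
    ∣C─K─Cᴴ∣≤∣C∩K∣ = injectiveOn⇒∣p∣≤∣q∣ partnerOf into injective
      where
      partnerOf : Fin (n G) → Fin (n G)
      partnerOf x = fromMaybe x (mate M x)
      unpack : x ∈ C ─ K ─ Covered Mᴴ → (∃[ y ] mate M x ≡ just y) × x ∉ K × x ∉ Covered Mᴴ
      unpack x∈ = ∈Covered⁻ M (p─q⊆p C K x∈C─K) , x∈p─q⇒x∉q C K x∈C─K , x∈p─q⇒x∉q _ _ x∈
        where x∈C─K = p─q⊆p _ _ x∈
      into : x ∈ C ─ K ─ Covered Mᴴ → partnerOf x ∈ C ∩ K
      into {x} x∈ with unpack x∈
      ... | (y , Mx≡y) , x∉K , x∉Cᴴ rewrite Mx≡y =
        x∈p∩q⁺ (∈Covered⁺ M (mate-sym M x y Mx≡y) , mate-∈K x∉K x∉Cᴴ Mx≡y)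
      injective : x ∈ C ─ K ─ Covered Mᴴ → y ∈ C ─ K ─ Covered Mᴴ → partnerOf x ≡ partnerOf y → x ≡ y
      injective x∈ x′∈ eq with unpack x∈ | unpack x′∈
      ... | (y , Mx≡y) , _ | (y′ , Mx′≡y′) , _ rewrite Mx≡y | Mx′≡y′ =
        mate-injective M Mx≡y (trans Mx′≡y′ (cong just (≡.sym eq)))

    covered-M : covered G M ≤ ∣ C ∩ K ∣ + (covered G Mᴴ + ∣ C ∩ K ∣)
    covered-M = begin
      ∣ C ∣
        ≡⟨ ∣p∣≡∣p∩q∣+∣p─q∣ C K ⟩
      ∣ C ∩ K ∣ + ∣ C ─ K ∣
        ≡⟨ cong (∣ C ∩ K ∣ +_) (∣p∣≡∣p∩q∣+∣p─q∣ (C ─ K) (Covered Mᴴ)) ⟩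
      ∣ C ∩ K ∣ + (∣ (C ─ K) ∩ Covered Mᴴ ∣ + ∣ C ─ K ─ Covered Mᴴ ∣)
        ≤⟨ +-monoʳ-≤ (∣ C ∩ K ∣) (+-mono-≤ (∣p∩q∣≤∣q∣ (C ─ K) (Covered Mᴴ)) ∣C─K─Cᴴ∣≤∣C∩K∣) ⟩
      ∣ C ∩ K ∣ + (covered G Mᴴ + ∣ C ∩ K ∣)
        ∎
      where open ≤-Reasoning

    covered-M+∣K∣ : covered G M + ∣ K ∣ ≤ covered G augmented + ∣ C ∩ K ∣
    covered-M+∣K∣ = begin
      covered G M + ∣ K ∣            ≤⟨ +-monoˡ-≤ (∣ K ∣) covered-M ⟩
      c + (h + c) + ∣ K ∣            ≡⟨ shuffle c h (∣ K ∣) ⟩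
      c + ∣ K ∣ + h + c              ≤⟨ +-monoˡ-≤ c (+-monoˡ-≤ h (+-monoˡ-≤ (∣ K ∣) (∣p∩q∣≤∣q∣ C K))) ⟩
      ∣ K ∣ + ∣ K ∣ + h + c          ≤⟨ +-monoˡ-≤ c covered-augmented ⟩
      covered G augmented + c        ∎
      where
      open ≤-Reasoning
      c = ∣ C ∩ K ∣
      h = covered G Mᴴ
      shuffle : ∀ a b d → a + (b + a) + d ≡ a + d + b + a
      shuffle = solve-∀

  covered≤covered-augmented : covered G M ≤ covered G augmented
  covered≤covered-augmented = +-cancelʳ-≤ (∣ K ∣) (covered G M) _
    (≤-trans covered-M+∣K∣ (+-monoʳ-≤ (covered G augmented) (∣p∩q∣≤∣q∣ C K)))

  covered<covered-augmented : x ∈ K → mate M x ≡ nothing → covered G M < covered G augmented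
  covered<covered-augmented {x = x} x∈K Mx≡nothing = +-cancelʳ-< (∣ K ∣) (covered G M) _
    (≤-<-trans covered-M+∣K∣ (+-monoʳ-< (covered G augmented) (p⊂q⇒∣p∣<∣q∣ C∩K⊂K)))
    where
    C∩K⊂K : C ∩ K ⊂ K
    C∩K⊂K = p∩q⊆q C K , x , x∈K , λ x∈C∩K → case ∈Covered⁻ M (proj₁ (x∈p∩q⁻ C K x∈C∩K)) of λ where
      (y , Mx≡y) → contradiction (trans (≡.sym Mx≡nothing) Mx≡y) λ ()

  augmented-unmatched : y ∈ J → (∀ {x} → x ∈ K → SaturatingMatching.partner σ x ≢ y) →
                        mate augmented y ≡ nothing
  augmented-unmatched y∈J unhit =
    trans (cong (_<∣> mate Mᴴ _) (fromSaturating-unmatched K∩J≡∅ σ y∈J unhit))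
          (↾-unmatched M H λ y∈H → x∈∁p⇒x∉p y∈H (x∈p∪q⁺ (inj₂ y∈J)))

module _ (G : Graph) {J : Subset (n G)} (J-independent : Independent G J) where

  open SaturatingMatching

  maximumMatching-covers-N : SaturatingMatching (adj G) (N G J) J → ∀ M → IsMaximumMatching G M →
                             x ∈ N G J → mate M x ≢ nothing
  maximumMatching-covers-N σ M M-maximum x∈NJ unmatched =
    <⇒≱ (covered<covered-augmented x∈NJ unmatched) (M-maximum augmented)
    where open Augmentation J-independent σ M

  avoidable⇒∈D : y ∈ J → SaturatingMatching (adj G) (N G J) (J - y) → InD G y
  avoidable⇒∈D {y = y} y∈J σ = augmented , augmented-maximum , augmented-unmatched y∈J y-avoided
    where
    open Augmentation J-independent (saturating-mono (adj G) ⊆-refl (p─q⊆p J ⁅ y ⁆) σ)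
                      (proj₁ (maximumMatching G))
    augmented-maximum : IsMaximumMatching G augmented
    augmented-maximum M = ≤-trans (proj₂ (maximumMatching G) M) covered≤covered-augmented
    y-avoided : x ∈ N G J → partner σ x ≢ y
    y-avoided x∈NJ σx≡y = x∉p-x (≡.subst (_∈ J - y) σx≡y (partner∈ σ x∈NJ))

mainTheorem12 : (G : Graph) (I : Subset (n G)) → CriticalIndependent G I →
      ((v : Fin (n G)) → v ∈ N G I → ¬ InD G v)
    × ((v : Fin (n G)) → v ∈ I → ¬ InA G v)
    × Σ (Subset (n G)) (λ J → CriticalIndependent G J
        × ((v : Fin (n G)) → v ∈ J → InD G v × v ∈ I))
mainTheorem12 G I (I-independent , I-critical)
  with ⊂-minimal (λ T → surplus G I ℤ.≤? surplus G T) (ℤ.≤-refl {surplus G I})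
... | J , J⊆I , I≼J , J-minimal =
  N[I]∩D≡∅ , I∩A≡∅ , J , (J-independent , J-critical) , λ v v∈J → J⊆D v∈J , J⊆I v∈J
  where
  N[I]∩D≡∅ : (v : Fin (n G)) → v ∈ N G I → ¬ InD G v
  N[I]∩D≡∅ v v∈NI (M , M-maximum , unmatched) =
    maximumMatching-covers-N G I-independent (hall (adj G) (critical⇒hallCondition G I I-critical))
                             M M-maximum v∈NI unmatched

  I∩A≡∅ : (v : Fin (n G)) → v ∈ I → ¬ InA G v
  I∩A≡∅ v v∈I (_ , u , u∈D , Auv) = N[I]∩D≡∅ u (∈neighbours⁺ (adj G) v∈I (adj-sym G Auv)) u∈D

  J-independent : Independent G J
  J-independent u v u∈J v∈J = I-independent u v (J⊆I u∈J) (J⊆I v∈J)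

  J-critical : IsMaxSurplus G J
  J-critical T = ℤ.≤-trans (I-critical T) I≼J

  J-minimal′ : ∀ T → T ⊂ J → ¬ surplus G J ℤ.≤ surplus G T
  J-minimal′ T T⊂J J≼T = J-minimal T T⊂J (ℤ.≤-trans I≼J J≼T)

  J⊆D : ∀ {v} → v ∈ J → InD G v
  J⊆D v∈J = avoidable⇒∈D G J-independent v∈J
    (hall (adj G) (minimalCritical⇒hallCondition G J J-critical J-minimal′ v∈J))
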